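{- Let $\lambda=(2^a,1^{n-2a})$ with $0\le a\le n/2$. Then $\mathcal{S}_\alpha$ is F-multiplicity free for all $\alpha\in\langle\lambda\rangle$ if and only if $a\le4$.
   Context: $i^m$ denotes $m$ consecutive parts equal to $i$. $\langle\lambda\rangle$ is the set of compositions whose parts, sorted into weakly decreasing order, give $\lambda$. For $\beta\vDash n$, $\mathrm{set}(\beta)=\{\beta_1,\beta_1+\beta_2,\dots\}$ (partial sums excluding $n$) and $F_\beta=\sum x_{i_1}\cdots x_{i_n}$ over $i_1\le\cdots\le i_n$ with $i_j<i_{j+1}$ whenever $j\in\mathrm{set}(\beta)$. The composition diagram of $\alpha$ has $\alpha_i$ left-justified cells in row $i$ (top to bottom). Cover relation: $\beta\lessdot\gamma$ if $\gamma=(1)\cdot\beta$ (new top row of one cell) or $\gamma$ is obtained from $\beta$ by adding $1$ to the leftmost part of $\beta$ equal to $k$, for some $k$ (cell added at the right end of that row). A standard composition tableau (SCT) of shape $\alpha\vDash n$ comes from a chain $\emptyset=\alpha^{n+1}\lessdot\cdots\lessdot\alpha^1=\alpha$ by putting $i$ in the cell added from $\alpha^{i+1}$ to $\alpha^i$. Its descent set is the set of $i$ with $i+1$ in a column weakly right of that of $i$; $\mathrm{com}(T)$ is the composition with this set. $\mathcal{S}_\alpha=\sum_T F_{\mathrm{com}(T)}$ over SCT $T$ of shape $\alpha$. A quasisymmetric function $\sum c_\beta F_\beta$ is F-multiplicity free if all $c_\beta\in\{0,1\}$. -}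

module Defs where

open import Data.Nat using (ℕ; zero; suc; _≤ᵇ_; _≟_; _∸_; _*_)
open import Data.List using (List; []; _∷_; _++_; map; reverse; replicate)
open import Data.Maybe using (Maybe; just; nothing; _>>=_)
import Data.Maybe as Maybe
open import Data.Bool using (if_then_else_)
open import Data.Product using (Σ; proj₁)
open import Relation.Nullary using (yes; no)
open import Relation.Binary.PropositionalEquality using (_≡_)

-- A composition is a list of (positive) parts, top row first.
Composition : Set
Composition = List ℕ

twoOne : ℕ → ℕ → Composition
twoOne n a = replicate a 2 ++ replicate (n ∸ (2 * a)) 1

-- One cover step β ⋖ γ :
--   new   : γ = (1)·β  (new top row with one cell, in column 1)
--   inc k : add 1 to the leftmost part of β equal to k (new cell in column k+1)
data Step : Set where
  new : Step
  inc : ℕ → Step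

incLeftmost : ℕ → Composition → Maybe Composition
incLeftmost k [] = nothing
incLeftmost k (x ∷ xs) with x ≟ k
... | yes _ = just (suc x ∷ xs)
... | no  _ = Maybe.map (x ∷_) (incLeftmost k xs)

applyStep : Step → Composition → Maybe Composition
applyStep new     β = just (1 ∷ β)
applyStep (inc k) β = incLeftmost k β

run : List Step → Composition → Maybe Composition
run []       β = just β
run (s ∷ ss) β = applyStep s β >>= run ss

column : Step → ℕ
column new     = 1
column (inc k) = suc k

-- A standard composition tableau of shape α: a maximal chain
-- ∅ = α^{n+1} ⋖ α^n ⋖ ⋯ ⋖ α^1 = α, recorded as its list of steps
-- [s_n , … , s_1] (the step from α^{i+1} to α^i adds the cell containing i).
SCT : Composition → Set
SCT α = Σ (List Step) (λ ss → run ss [] ≡ just α)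

columns : List Step → List ℕ
columns ss = reverse (map column ss)

-- composition whose set is the descent set {i : c_{i+1} ≥ c_i}
comGo : ℕ → ℕ → List ℕ → Composition
comGo k p []       = k ∷ []
comGo k p (c ∷ cs) = if p ≤ᵇ c then k ∷ comGo 1 c cs else comGo (suc k) c cs

comCols : List ℕ → Composition
comCols []       = []
comCols (c ∷ cs) = comGo 1 c cs

com : {α : Composition} → SCT α → Composition
com T = comCols (columns (proj₁ T))

-- S_α = Σ_T F_{com T}; since the F_β are a basis, the coefficient of F_β is
-- #{T : com T = β}.  F-multiplicity free ⇔ every such count is ≤ 1, i.e.
-- distinct SCTs of shape α have distinct com.
FMultFree : Composition → Set
FMultFree α = (T T′ : SCT α) → com T ≡ com T′ → proj₁ T ≡ proj₁ T′

-- A shape with parts 1 and 2 only admits chains of new rows and cells in column 2, and com T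
-- determines the descent word of T. Write such a shape as (2^p, 1, β): that row 1 is created by a
-- step that nothing touches afterwards, so every chain splits into a chain of shape β, that step,
-- and a chain of shape (2^p) on top, of length 2p. The descent word of the whole therefore
-- determines those of both pieces, and F-multiplicity freeness reduces to the blocks (2^p) with
-- p ≤ 4, a finite check. For a ≥ 5, two tableaux of shape (2^5) with equal descents and equal last
-- column, stacked on a common chain of the remaining rows, have the same com.
module Submission where

open import Defs
open import Data.Bool using (Bool; true; false)
import Data.Bool as Bool
open import Data.Empty using (⊥-elim)
open import Data.List using (List; []; _∷_; _++_; [_]; map; reverse; replicate; length; filter; take; drop)
open import Data.List.Properties
  using (++-assoc; ++-identityʳ; ++-cancelˡ; map-++; reverse-++; length-++; length-map; length-reverse;
         length-++-≤ʳ; ∷-injective; ∷-injectiveˡ; ∷-injectiveʳ; ≡-dec)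
open import Data.List.Membership.Propositional using (_∈_)
open import Data.List.Membership.Propositional.Properties using (∈-++⁺ˡ; ∈-++⁺ʳ; ∈-map⁺; ∈-filter⁺)
open import Data.List.Relation.Binary.Permutation.Propositional using (_↭_; ↭-refl; ↭-sym)
open import Data.List.Relation.Binary.Permutation.Propositional.Properties using (All-resp-↭; filter-↭; ↭-length)
import Data.List.Relation.Binary.Pointwise as Pointwise
open Pointwise using (Pointwise; []; _∷_; Pointwise-length)
open import Data.List.Relation.Unary.All using (All; []; _∷_; all?)
import Data.List.Relation.Unary.All as All
import Data.List.Relation.Unary.All.Properties as All
open import Data.List.Relation.Unary.Any using (here; there)
open import Data.Maybe using (just; nothing; _>>=_)
import Data.Maybe as Maybe
import Data.Maybe.Properties as Maybe
open import Data.Nat using (ℕ; zero; suc; _+_; _*_; _∸_; _≤_; _<_; s≤s; _≤ᵇ_; _≟_; _≤?_)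
open import Data.Nat.ListAction using (sum)
open import Data.Nat.Properties
  using (≤-refl; ≤-trans; ≤-reflexive; n≤1+n; n≮n; +-suc; +-identityʳ; +-cancelʳ-≡;
         suc-injective; m+n≤o⇒m≤o; m+n≤o⇒n≤o; ≰⇒>; m≤n⇒∃[o]m+o≡n)
open import Data.Product using (∃; ∃₂; _×_; _,_; proj₁; proj₂)
open import Data.Unit using (tt)
open import Function.Bundles using (_⇔_; mk⇔)
open import Relation.Binary.Definitions using (DecidableEquality)
open import Relation.Binary.PropositionalEquality
  using (_≡_; _≢_; refl; sym; trans; cong; cong₂; subst; subst₂; module ≡-Reasoning)
open import Relation.Nullary using (yes; no; ¬_; Dec)
open import Relation.Nullary.Decidable using (True; toWitness; _→-dec_)

open ≡-Reasoning

++-injective : ∀ {A : Set} (xs xs′ : List A) {ys ys′ : List A} → length xs ≡ length xs′ →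
  xs ++ ys ≡ xs′ ++ ys′ → xs ≡ xs′ × ys ≡ ys′
++-injective []       []         _ e = refl , e
++-injective (x ∷ xs) (x′ ∷ xs′) l e with ∷-injective e
... | refl , e′ with ++-injective xs xs′ (suc-injective l) e′
...   | refl , refl = refl , refl

++-injective-suffix : ∀ {A : Set} (xs xs′ : List A) {ys ys′ : List A} → length ys ≡ length ys′ →
  xs ++ ys ≡ xs′ ++ ys′ → xs ≡ xs′ × ys ≡ ys′
++-injective-suffix xs xs′ {ys} {ys′} l e = ++-injective xs xs′ (+-cancelʳ-≡ (length ys) _ _ lengths) e
  where
  lengths : length xs + length ys ≡ length xs′ + length ys
  lengths = begin
    length xs + length ys    ≡⟨ length-++ xs ⟨
    length (xs ++ ys)        ≡⟨ cong length e ⟩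
    length (xs′ ++ ys′)      ≡⟨ length-++ xs′ ⟩
    length xs′ + length ys′  ≡⟨ cong (length xs′ +_) l ⟨
    length xs′ + length ys   ∎

data OneOrTwo : ℕ → Set where
  one : OneOrTwo 1
  two : OneOrTwo 2

data Narrow : Step → Set where
  new  : Narrow new
  inc₁ : Narrow (inc 1)

twos : Composition → ℕ
twos α = length (filter (_≟ 2) α)

incLeftmost-++ˡ : ∀ k xs {xs′} ys → incLeftmost k xs ≡ just xs′ → incLeftmost k (xs ++ ys) ≡ just (xs′ ++ ys)
incLeftmost-++ˡ k (x ∷ xs) ys e with x ≟ k
incLeftmost-++ˡ k (x ∷ xs) ys refl | yes _ = refl
incLeftmost-++ˡ k (x ∷ xs) ys e    | no _ with incLeftmost k xs in e′
incLeftmost-++ˡ k (x ∷ xs) ys refl | no _ | just _ = cong (Maybe.map (x ∷_)) (incLeftmost-++ˡ k xs ys e′)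

incLeftmost-++ʳ : ∀ k xs ys → incLeftmost k xs ≡ nothing →
  incLeftmost k (xs ++ ys) ≡ Maybe.map (xs ++_) (incLeftmost k ys)
incLeftmost-++ʳ k []       ys _ = sym (Maybe.map-id (incLeftmost k ys))
incLeftmost-++ʳ k (x ∷ xs) ys e with x ≟ k
incLeftmost-++ʳ k (x ∷ xs) ys () | yes _
incLeftmost-++ʳ k (x ∷ xs) ys e  | no _ with incLeftmost k xs in e′
incLeftmost-++ʳ k (x ∷ xs) ys refl | no _ | nothing =
  trans (cong (Maybe.map (x ∷_)) (incLeftmost-++ʳ k xs ys e′)) (sym (Maybe.map-∘ (incLeftmost k ys)))

incLeftmost-grows : ∀ k xs {ys} → incLeftmost k xs ≡ just ys → Pointwise _≤_ xs ys
incLeftmost-grows k (x ∷ xs) e with x ≟ k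
incLeftmost-grows k (x ∷ xs) refl | yes _ = n≤1+n x ∷ Pointwise.refl ≤-refl
incLeftmost-grows k (x ∷ xs) e    | no _ with incLeftmost k xs in e′
incLeftmost-grows k (x ∷ xs) refl | no _ | just _ = ≤-refl ∷ incLeftmost-grows k xs e′

incLeftmost-sum : ∀ k xs {ys} → incLeftmost k xs ≡ just ys → sum ys ≡ suc (sum xs)
incLeftmost-sum k (x ∷ xs) e with x ≟ k
incLeftmost-sum k (x ∷ xs) refl | yes _ = refl
incLeftmost-sum k (x ∷ xs) e    | no _ with incLeftmost k xs in e′
incLeftmost-sum k (x ∷ xs) refl | no _ | just _ = trans (cong (x +_) (incLeftmost-sum k xs e′)) (+-suc x _)

incLeftmost-∈ : ∀ k xs {ys} → incLeftmost k xs ≡ just ys → k ∈ xs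
incLeftmost-∈ k (x ∷ xs) e with x ≟ k
incLeftmost-∈ k (x ∷ xs) e    | yes refl = here refl
incLeftmost-∈ k (x ∷ xs) e    | no _ with incLeftmost k xs in e′
incLeftmost-∈ k (x ∷ xs) refl | no _ | just _ = there (incLeftmost-∈ k xs e′)

incLeftmost-All : ∀ {P : ℕ → Set} k xs {ys} → incLeftmost k xs ≡ just ys → P (suc k) → All P xs → All P ys
incLeftmost-All k (x ∷ xs) e    Pk (Px ∷ Pxs) with x ≟ k
incLeftmost-All k (x ∷ xs) refl Pk (Px ∷ Pxs) | yes refl = Pk ∷ Pxs
incLeftmost-All k (x ∷ xs) e    Pk (Px ∷ Pxs) | no _ with incLeftmost k xs in e′
incLeftmost-All k (x ∷ xs) refl Pk (Px ∷ Pxs) | no _ | just _ = Px ∷ incLeftmost-All k xs e′ Pk Pxs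

run-++ : ∀ xs ys σ → run (xs ++ ys) σ ≡ (run xs σ >>= run ys)
run-++ []       ys σ = refl
run-++ (s ∷ xs) ys σ with applyStep s σ
... | nothing = refl
... | just σ′ = run-++ xs ys σ′

run-cells : ∀ w σ {τ} → run w σ ≡ just τ → length w + sum σ ≡ sum τ
run-cells []          σ refl = refl
run-cells (new ∷ w)   σ r    = trans (sym (+-suc (length w) (sum σ))) (run-cells w (1 ∷ σ) r)
run-cells (inc k ∷ w) σ {τ} r with incLeftmost k σ in e
... | just σ′ = begin
  suc (length w + sum σ)  ≡⟨ +-suc (length w) (sum σ) ⟨
  length w + suc (sum σ)  ≡⟨ cong (length w +_) (incLeftmost-sum k σ e) ⟨
  length w + sum σ′       ≡⟨ run-cells w σ′ r ⟩
  sum τ                   ∎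

run-length : ∀ w {α} → run w [] ≡ just α → length w ≡ sum α
run-length w r = trans (sym (+-identityʳ (length w))) (run-cells w [] r)

newCount : List Step → ℕ
newCount []          = 0
newCount (new ∷ w)   = suc (newCount w)
newCount (inc _ ∷ w) = newCount w

run-rows : ∀ w σ {τ} → run w σ ≡ just τ → length τ ≡ newCount w + length σ
run-rows []          σ refl = refl
run-rows (new ∷ w)   σ r    = trans (run-rows w (1 ∷ σ) r) (+-suc (newCount w) (length σ))
run-rows (inc k ∷ w) σ r with incLeftmost k σ in e
... | just σ′ = trans (run-rows w σ′ r)
                  (cong (newCount w +_) (sym (Pointwise-length (incLeftmost-grows k σ e))))

split-at-new : ∀ m w → m < newCount w → ∃₂ λ v d → w ≡ v ++ new ∷ d × newCount v ≡ m
split-at-new zero    (new ∷ w)   _         = [] , w , refl , refl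
split-at-new (suc m) (new ∷ w)   (s≤s m<n) with split-at-new m w m<n
... | v , d , refl , refl = new ∷ v , d , refl , refl
split-at-new m       (inc k ∷ w) m<n with split-at-new m w m<n
... | v , d , refl , refl = inc k ∷ v , d , refl , refl

record PartAtLeast (x i : ℕ) (τ : Composition) : Set where
  constructor part
  field
    above : Composition
    size  : ℕ
    below : Composition
    splits : τ ≡ above ++ size ∷ below
    height : length below ≡ i
    large  : x ≤ size

PartAtLeast-grows : ∀ {x i τ τ′} → Pointwise _≤_ τ τ′ → PartAtLeast x i τ → PartAtLeast x i τ′
PartAtLeast-grows (y≤y′ ∷ γ≤γ′) (part [] y γ refl h x≤y) =
  part [] _ _ refl (trans (sym (Pointwise-length γ≤γ′)) h) (≤-trans x≤y y≤y′)
PartAtLeast-grows {τ′ = t ∷ τ′} (_ ∷ τ≤τ′) (part (s ∷ σ) y γ refl h x≤y)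
  with PartAtLeast-grows τ≤τ′ (part σ y γ refl h x≤y)
... | part σ′ y′ γ′ refl h′ x≤y′ = part (t ∷ σ′) y′ γ′ refl h′ x≤y′

run-PartAtLeast : ∀ w {x i τ τ′} → run w τ ≡ just τ′ → PartAtLeast x i τ → PartAtLeast x i τ′
run-PartAtLeast []          refl p = p
run-PartAtLeast (new ∷ w)   r    (part σ y γ refl h x≤y) = run-PartAtLeast w r (part (1 ∷ σ) y γ refl h x≤y)
run-PartAtLeast (inc k ∷ w) {τ = τ} r p with incLeftmost k τ in e
... | just τ₁ = run-PartAtLeast w r (PartAtLeast-grows (incLeftmost-grows k τ e) p)

PartAtLeast-at : ∀ {x y} ρ γ → PartAtLeast x (length γ) (ρ ++ y ∷ γ) → x ≤ y
PartAtLeast-at ρ γ (part σ y′ γ′ e h x≤y′) with ++-injective-suffix ρ σ (cong suc (sym h)) e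
... | _ , refl = x≤y′

OneOrTwo-¬PartAtLeast3 : ∀ {i τ} → All OneOrTwo τ → ¬ PartAtLeast 3 i τ
OneOrTwo-¬PartAtLeast3 oτ (part σ y γ refl _ 3≤y) with All.head (All.++⁻ʳ σ oτ)
OneOrTwo-¬PartAtLeast3 oτ (part σ y γ refl _ (s≤s ())) | one
OneOrTwo-¬PartAtLeast3 oτ (part σ y γ refl _ (s≤s (s≤s ()))) | two

incLeftmost-creates : ∀ k xs {ys} → incLeftmost k xs ≡ just ys → ∃ λ i → PartAtLeast (suc k) i ys
incLeftmost-creates k (x ∷ xs) e    with x ≟ k
incLeftmost-creates k (x ∷ xs) refl | yes refl = length xs , part [] (suc k) xs refl refl ≤-refl
incLeftmost-creates k (x ∷ xs) e    | no _ with incLeftmost k xs in e′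
incLeftmost-creates k (x ∷ xs) refl | no _ | just _ with incLeftmost-creates k xs e′
... | i , part σ y γ refl h k<y = i , part (x ∷ σ) y γ refl h k<y

-- A step incrementing a part 2 leaves a part 3 for good.
narrow-steps : ∀ w σ {α} → All OneOrTwo σ → run w σ ≡ just α → All OneOrTwo α → All Narrow w
narrow-steps []          σ oσ r    oα = []
narrow-steps (new ∷ w)   σ oσ r    oα = new ∷ narrow-steps w (1 ∷ σ) (one ∷ oσ) r oα
narrow-steps (inc k ∷ w) σ oσ r    oα with incLeftmost k σ in e
... | just σ′ with All.lookup oσ (incLeftmost-∈ k σ e)
...   | one = inc₁ ∷ narrow-steps w σ′ (incLeftmost-All 1 σ e two oσ) r oα
...   | two with incLeftmost-creates 2 σ e
...     | _ , p = ⊥-elim (OneOrTwo-¬PartAtLeast3 oα (run-PartAtLeast w r p))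

-- A part 1 that is still 1 at the end was never touched: narrow steps would have made it 2 for good.
run-frame : ∀ w σ γ {ρ γ′} → All Narrow w → length γ′ ≡ length γ →
  run w (σ ++ 1 ∷ γ) ≡ just (ρ ++ 1 ∷ γ′) → run w σ ≡ just ρ × γ ≡ γ′
run-frame []          σ γ {ρ} [] h r with ++-injective-suffix σ ρ (cong suc (sym h)) (Maybe.just-injective r)
... | refl , refl = refl , refl
run-frame (new ∷ w)   σ γ (new ∷ nw) h r = run-frame w (1 ∷ σ) γ nw h r
run-frame (inc 1 ∷ w) σ γ {ρ} {γ′} (inc₁ ∷ nw) h r with incLeftmost 1 σ in e
... | just σ′ = run-frame w σ′ γ nw h (trans (cong (_>>= run w) (sym (incLeftmost-++ˡ 1 σ (1 ∷ γ) e))) r)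
... | nothing = ⊥-elim (n≮n 1 (PartAtLeast-at ρ γ′ (subst (λ i → PartAtLeast 2 i (ρ ++ 1 ∷ γ′)) (sym h) grown)))
  where
  r₂ : run w (σ ++ 2 ∷ γ) ≡ just (ρ ++ 1 ∷ γ′)
  r₂ = trans (cong (_>>= run w) (sym (incLeftmost-++ʳ 1 σ (1 ∷ γ) e))) r
  grown : PartAtLeast 2 (length γ) (ρ ++ 1 ∷ γ′)
  grown = run-PartAtLeast w r₂ (part σ 2 γ refl refl ≤-refl)

record SplitAtOne (w : List Step) (ρ β : Composition) : Set where
  constructor split
  field
    lower upper  : List Step
    steps        : w ≡ lower ++ new ∷ upper
    narrow-lower : All Narrow lower
    narrow-upper : All Narrow upper
    runs-lower   : run lower [] ≡ just β
    runs-upper   : run upper [] ≡ just ρ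

length-below<newCount : ∀ w {ρ β} → run w [] ≡ just (ρ ++ 1 ∷ β) → length β < newCount w
length-below<newCount w {ρ} {β} r =
  ≤-trans (length-++-≤ʳ (1 ∷ β) {ρ}) (≤-reflexive (trans (run-rows w [] r) (+-identityʳ _)))

narrow-split : ∀ {w} ρ β → All Narrow w → run w [] ≡ just (ρ ++ 1 ∷ β) → SplitAtOne w ρ β
narrow-split {w} ρ β nw r with split-at-new (length β) w (length-below<newCount w r)
... | v , d , refl , |v| with run v [] in rv | trans (sym (run-++ v (new ∷ d) [])) r
...   | just s | rd
  with run-frame d [] s (All.tail (All.++⁻ʳ v nw)) (sym (trans (run-rows v [] rv) (trans (+-identityʳ _) |v|))) rd
...     | rd′ , refl = split v d refl (All.++⁻ˡ v nw) (All.tail (All.++⁻ʳ v nw)) rv rd′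

descentsFrom : ℕ → List ℕ → List Bool
descentsFrom p []       = []
descentsFrom p (c ∷ cs) = (p ≤ᵇ c) ∷ descentsFrom c cs

descents : List ℕ → List Bool
descents []       = []
descents (c ∷ cs) = descentsFrom c cs

comGo-head : ∀ k p cs → ∃₂ λ h t → comGo k p cs ≡ h ∷ t × k ≤ h
comGo-head k p []       = k , [] , refl , ≤-refl
comGo-head k p (c ∷ cs) with p ≤ᵇ c
... | true  = k , comGo 1 c cs , refl , ≤-refl
... | false with comGo-head (suc k) c cs
...   | h , t , e , k<h = h , t , e , ≤-trans (n≤1+n k) k<h

comGo-≢[] : ∀ k p cs → comGo k p cs ≢ []
comGo-≢[] k p cs e with comGo-head k p cs
... | _ , _ , e′ , _ with trans (sym e) e′
... | ()

comGo-≢-smaller : ∀ k p cs {t} → comGo (suc k) p cs ≢ k ∷ t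
comGo-≢-smaller k p cs e with comGo-head (suc k) p cs
... | h , _ , e′ , k<h with ∷-injectiveˡ (trans (sym e) e′)
... | refl = n≮n k k<h

comGo-injective : ∀ k p p′ cs cs′ → comGo k p cs ≡ comGo k p′ cs′ → descentsFrom p cs ≡ descentsFrom p′ cs′
comGo-injective k p p′ []       []         e = refl
comGo-injective k p p′ []       (c′ ∷ cs′) e with p′ ≤ᵇ c′
... | true  = ⊥-elim (comGo-≢[] 1 c′ cs′ (sym (∷-injectiveʳ e)))
... | false = ⊥-elim (comGo-≢-smaller k c′ cs′ (sym e))
comGo-injective k p p′ (c ∷ cs) []         e with p ≤ᵇ c
... | true  = ⊥-elim (comGo-≢[] 1 c cs (∷-injectiveʳ e))
... | false = ⊥-elim (comGo-≢-smaller k c cs e)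
comGo-injective k p p′ (c ∷ cs) (c′ ∷ cs′) e with p ≤ᵇ c | p′ ≤ᵇ c′
... | true  | true  = cong (true ∷_) (comGo-injective 1 c c′ cs cs′ (∷-injectiveʳ e))
... | false | false = cong (false ∷_) (comGo-injective (suc k) c c′ cs cs′ e)
... | true  | false = ⊥-elim (comGo-≢-smaller k c′ cs′ (sym e))
... | false | true  = ⊥-elim (comGo-≢-smaller k c cs e)

comCols-injective : ∀ cs cs′ → comCols cs ≡ comCols cs′ → descents cs ≡ descents cs′
comCols-injective []       []         e = refl
comCols-injective []       (c′ ∷ cs′) e = ⊥-elim (comGo-≢[] 1 c′ cs′ (sym e))
comCols-injective (c ∷ cs) []         e = ⊥-elim (comGo-≢[] 1 c cs e)
comCols-injective (c ∷ cs) (c′ ∷ cs′) e = comGo-injective 1 c c′ cs cs′ e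

take-descentsFrom-++ : ∀ p xs ys → take (length xs) (descentsFrom p (xs ++ ys)) ≡ descentsFrom p xs
take-descentsFrom-++ p []       ys = refl
take-descentsFrom-++ p (x ∷ xs) ys = cong ((p ≤ᵇ x) ∷_) (take-descentsFrom-++ x xs ys)

drop-descentsFrom-++ : ∀ p xs ys → drop (suc (length xs)) (descentsFrom p (xs ++ ys)) ≡ descents ys
drop-descentsFrom-++ p []       []       = refl
drop-descentsFrom-++ p []       (y ∷ ys) = refl
drop-descentsFrom-++ p (x ∷ xs) ys       = drop-descentsFrom-++ x xs ys

descents-++-injective : ∀ xs xs′ {ys ys′} → length xs ≡ length xs′ →
  descents (xs ++ ys) ≡ descents (xs′ ++ ys′) → descents xs ≡ descents xs′ × descents ys ≡ descents ys′
descents-++-injective []       []           _ e = refl , e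
descents-++-injective (x ∷ xs) (x′ ∷ xs′) {ys} {ys′} l e =
  (begin
    descentsFrom x xs                                  ≡⟨ take-descentsFrom-++ x xs ys ⟨
    take (length xs) (descentsFrom x (xs ++ ys))       ≡⟨ cong (take (length xs)) e ⟩
    take (length xs) (descentsFrom x′ (xs′ ++ ys′))    ≡⟨ cong (λ n → take n _) (suc-injective l) ⟩
    take (length xs′) (descentsFrom x′ (xs′ ++ ys′))   ≡⟨ take-descentsFrom-++ x′ xs′ ys′ ⟩
    descentsFrom x′ xs′                                ∎) ,
  (begin
    descents ys                                              ≡⟨ drop-descentsFrom-++ x xs ys ⟨
    drop (length (x ∷ xs)) (descentsFrom x (xs ++ ys))      ≡⟨ cong₂ drop l e ⟩
    drop (length (x′ ∷ xs′)) (descentsFrom x′ (xs′ ++ ys′))  ≡⟨ drop-descentsFrom-++ x′ xs′ ys′ ⟩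
    descents ys′                                             ∎)

columns-++ : ∀ xs ys → columns (xs ++ ys) ≡ columns ys ++ columns xs
columns-++ xs ys = trans (cong reverse (map-++ column xs ys)) (reverse-++ (map column xs) (map column ys))

length-columns : ∀ w → length (columns w) ≡ length w
length-columns w = trans (length-reverse (map column w)) (length-map column w)

columns-around-new : ∀ v d → columns (v ++ new ∷ d) ≡ columns d ++ 1 ∷ columns v
columns-around-new v d = begin
  columns (v ++ [ new ] ++ d)           ≡⟨ columns-++ v ([ new ] ++ d) ⟩
  columns ([ new ] ++ d) ++ columns v   ≡⟨ cong (_++ columns v) (columns-++ [ new ] d) ⟩
  (columns d ++ [ 1 ]) ++ columns v     ≡⟨ ++-assoc (columns d) [ 1 ] (columns v) ⟩
  columns d ++ 1 ∷ columns v            ∎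

descents-around-new : ∀ v d v′ d′ → length d ≡ length d′ →
  descents (columns (v ++ new ∷ d)) ≡ descents (columns (v′ ++ new ∷ d′)) →
  descents (columns d) ≡ descents (columns d′) × descents (columns v) ≡ descents (columns v′)
descents-around-new v d v′ d′ l e =
  proj₁ halves , proj₂ (descents-++-injective [ 1 ] [ 1 ] refl (proj₂ halves))
  where
  halves : descents (columns d) ≡ descents (columns d′) × descents (1 ∷ columns v) ≡ descents (1 ∷ columns v′)
  halves = descents-++-injective (columns d) (columns d′)
    (trans (length-columns d) (trans l (sym (length-columns d′))))
    (subst₂ (λ cs cs′ → descents cs ≡ descents cs′) (columns-around-new v d) (columns-around-new v′ d′) e)

DescentsDetermine : Composition → Set
DescentsDetermine α = ∀ {w w′} → All Narrow w → All Narrow w′ → run w [] ≡ just α → run w′ [] ≡ just α →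
  descents (columns w) ≡ descents (columns w′) → w ≡ w′

DescentsDetermine⇒FMultFree : ∀ {α} → All OneOrTwo α → DescentsDetermine α → FMultFree α
DescentsDetermine⇒FMultFree oα determine (w , r) (w′ , r′) same-com =
  determine (narrow-steps w [] [] r oα) (narrow-steps w′ [] [] r′ oα) r r′
            (comCols-injective (columns w) (columns w′) same-com)

DescentsDetermine-split : ∀ ρ β → DescentsDetermine ρ → DescentsDetermine β → DescentsDetermine (ρ ++ 1 ∷ β)
DescentsDetermine-split ρ β determineρ determineβ nw nw′ r r′ same
  with narrow-split ρ β nw r | narrow-split ρ β nw′ r′
... | split v d refl nv nd rv rd | split v′ d′ refl nv′ nd′ rv′ rd′
  with descents-around-new v d v′ d′ (trans (run-length d rd) (sym (run-length d′ rd′))) same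
... | same-d , same-v =
  cong₂ (λ lower upper → lower ++ new ∷ upper) (determineβ nv nv′ rv rv′ same-v) (determineρ nd nd′ rd rd′ same-d)

narrowWords : ℕ → List (List Step)
narrowWords zero    = [ [] ]
narrowWords (suc n) = map (new ∷_) (narrowWords n) ++ map (inc 1 ∷_) (narrowWords n)

∈-narrowWords : ∀ {w} → All Narrow w → w ∈ narrowWords (length w)
∈-narrowWords []                  = here refl
∈-narrowWords (new ∷ nw)          = ∈-++⁺ˡ (∈-map⁺ (new ∷_) (∈-narrowWords nw))
∈-narrowWords {_ ∷ w} (inc₁ ∷ nw) =
  ∈-++⁺ʳ (map (new ∷_) (narrowWords (length w))) (∈-map⁺ (inc 1 ∷_) (∈-narrowWords nw))

narrowChains : Composition → List (List Step)
narrowChains α = filter (λ w → Maybe.≡-dec (≡-dec _≟_) (run w []) (just α)) (narrowWords (sum α))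

∈-narrowChains : ∀ {w α} → All Narrow w → run w [] ≡ just α → w ∈ narrowChains α
∈-narrowChains {w} nw r =
  ∈-filter⁺ (λ w → Maybe.≡-dec (≡-dec _≟_) (run w []) (just _))
            (subst (λ n → w ∈ narrowWords n) (run-length w r) (∈-narrowWords nw)) r

DescentsInjective : List (List Step) → Set
DescentsInjective ws = All (λ w → All (λ w′ → descents (columns w) ≡ descents (columns w′) → w ≡ w′) ws) ws

_≟-step_ : DecidableEquality Step
new   ≟-step new    = yes refl
new   ≟-step inc _  = no λ ()
inc _ ≟-step new    = no λ ()
inc k ≟-step inc k′ with k ≟ k′
... | yes refl = yes refl
... | no k≢k′  = no λ { refl → k≢k′ refl }

descentsInjective? : ∀ ws → Dec (DescentsInjective ws)
descentsInjective? ws =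
  all? (λ w → all? (λ w′ → ≡-dec Bool._≟_ (descents (columns w)) (descents (columns w′)) →-dec ≡-dec _≟-step_ w w′) ws) ws

DescentsDetermine-byEnumeration : ∀ α → DescentsInjective (narrowChains α) → DescentsDetermine α
DescentsDetermine-byEnumeration α injective nw nw′ r r′ =
  All.lookup (All.lookup injective (∈-narrowChains nw r)) (∈-narrowChains nw′ r′)

DescentsDetermine-twoRows : ∀ p → p ≤ 4 → DescentsDetermine (replicate p 2)
DescentsDetermine-twoRows p p≤4 = DescentsDetermine-byEnumeration (replicate p 2) (toWitness (checked p p≤4))
  where
  checked : ∀ q → q ≤ 4 → True (descentsInjective? (narrowChains (replicate q 2)))
  checked 0 _ = tt
  checked 1 _ = tt
  checked 2 _ = tt
  checked 3 _ = tt
  checked 4 _ = tt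
  checked (suc (suc (suc (suc (suc _))))) (s≤s (s≤s (s≤s (s≤s ()))))

data Blocks : ℕ → Composition → Set where
  rows₂ : ∀ p → Blocks p (replicate p 2)
  _▸_   : ∀ p {t β} → Blocks t β → Blocks (p + t) (replicate p 2 ++ 1 ∷ β)

blocks : ∀ {α} → All OneOrTwo α → Blocks (twos α) α
blocks []         = rows₂ 0
blocks (one ∷ oα) = 0 ▸ blocks oα
blocks (two ∷ oα) = add-two (blocks oα)
  where
  add-two : ∀ {t α} → Blocks t α → Blocks (suc t) (2 ∷ α)
  add-two (rows₂ p) = rows₂ (suc p)
  add-two (p ▸ b)   = suc p ▸ b

DescentsDetermine-blocks : ∀ {t α} → Blocks t α → t ≤ 4 → DescentsDetermine α
DescentsDetermine-blocks (rows₂ p) p≤4 = DescentsDetermine-twoRows p p≤4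
DescentsDetermine-blocks (p ▸ b)   p+t≤4 =
  DescentsDetermine-split _ _ (DescentsDetermine-twoRows p (m+n≤o⇒m≤o p p+t≤4))
                              (DescentsDetermine-blocks b (m+n≤o⇒n≤o p p+t≤4))

twos-↭ : ∀ {xs ys} → xs ↭ ys → twos xs ≡ twos ys
twos-↭ xs↭ys = ↭-length (filter-↭ (_≟ 2) xs↭ys)

twos-twoOne : ∀ n a → twos (twoOne n a) ≡ a
twos-twoOne n a = trans (twos-twos a) (trans (cong (a +_) (twos-ones (n ∸ 2 * a))) (+-identityʳ a))
  where
  twos-twos : ∀ p {r} → twos (replicate p 2 ++ r) ≡ p + twos r
  twos-twos zero    = refl
  twos-twos (suc p) = cong suc (twos-twos p)
  twos-ones : ∀ m → twos (replicate m 1) ≡ 0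
  twos-ones zero    = refl
  twos-ones (suc m) = twos-ones m

twoOne-OneOrTwo : ∀ n a → All OneOrTwo (twoOne n a)
twoOne-OneOrTwo n a = All.++⁺ (All.replicate⁺ a two) (All.replicate⁺ (n ∸ 2 * a) one)

permutedTwoOne-FMultFree : ∀ n a → a ≤ 4 → (α : Composition) → α ↭ twoOne n a → FMultFree α
permutedTwoOne-FMultFree n a a≤4 α α↭ =
  DescentsDetermine⇒FMultFree oα (DescentsDetermine-blocks (blocks oα) twos≤4)
  where
  oα : All OneOrTwo α
  oα = All-resp-↭ (↭-sym α↭) (twoOne-OneOrTwo n a)
  twos≤4 : twos α ≤ 4
  twos≤4 = subst (_≤ 4) (sym (trans (twos-↭ α↭) (twos-twoOne n a))) a≤4

stacked : ℕ → List Step → List Step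
stacked zero    b = []
stacked (suc m) b = stacked m b ++ b

run-stacked : ∀ {x} b → (∀ σ → run b σ ≡ just (x ∷ σ)) → ∀ m σ → run (stacked m b) σ ≡ just (replicate m x ++ σ)
run-stacked b adds-x zero    σ = refl
run-stacked {x} b adds-x (suc m) σ = begin
  run (stacked m b ++ b) σ         ≡⟨ run-++ (stacked m b) b σ ⟩
  (run (stacked m b) σ >>= run b)  ≡⟨ cong (_>>= run b) (run-stacked b adds-x m σ) ⟩
  run b (replicate m x ++ σ)       ≡⟨ adds-x (replicate m x ++ σ) ⟩
  just (replicate (suc m) x ++ σ)  ∎

twoOneChain : ℕ → ℕ → List Step
twoOneChain j m = stacked m [ new ] ++ stacked j (new ∷ inc 1 ∷ [])

run-twoOneChain : ∀ j m σ → run (twoOneChain j m) σ ≡ just (replicate j 2 ++ replicate m 1 ++ σ)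
run-twoOneChain j m σ = begin
  run (stacked m [ new ] ++ stacked j pair) σ           ≡⟨ run-++ (stacked m [ new ]) (stacked j pair) σ ⟩
  (run (stacked m [ new ]) σ >>= run (stacked j pair))  ≡⟨ cong (_>>= run (stacked j pair)) (run-stacked [ new ] (λ _ → refl) m σ) ⟩
  run (stacked j pair) (replicate m 1 ++ σ)             ≡⟨ run-stacked pair (λ _ → refl) j (replicate m 1 ++ σ) ⟩
  just (replicate j 2 ++ replicate m 1 ++ σ)            ∎
  where
  pair : List Step
  pair = new ∷ inc 1 ∷ []

-- Two tableaux of shape (2⁵) whose column words 2211212211 and 2212211211 have the same
-- descents and end in the same column, so com agrees after any continuation.
collision₁ collision₂ : List Step
collision₁ = new ∷ new ∷ inc 1 ∷ inc 1 ∷ new ∷ inc 1 ∷ new ∷ new ∷ inc 1 ∷ inc 1 ∷ []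
collision₂ = new ∷ new ∷ inc 1 ∷ new ∷ new ∷ inc 1 ∷ inc 1 ∷ new ∷ inc 1 ∷ inc 1 ∷ []

collision₁≢collision₂ : collision₁ ≢ collision₂
collision₁≢collision₂ ()

twoOne-¬FMultFree : ∀ n j → ¬ FMultFree (twoOne n (5 + j))
twoOne-¬FMultFree n j free = collision₁≢collision₂ (++-cancelˡ base collision₁ collision₂
  (free (base ++ collision₁ , runs collision₁ (λ _ → refl)) (base ++ collision₂ , runs collision₂ (λ _ → refl)) same-com))
  where
  m : ℕ
  m = n ∸ 2 * (5 + j)
  base : List Step
  base = twoOneChain j m
  runs : ∀ c → (∀ σ → run c σ ≡ just (2 ∷ 2 ∷ 2 ∷ 2 ∷ 2 ∷ σ)) → run (base ++ c) [] ≡ just (twoOne n (5 + j))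
  runs c adds-2⁵ = begin
    run (base ++ c) []                                 ≡⟨ run-++ base c [] ⟩
    (run base [] >>= run c)                            ≡⟨ cong (_>>= run c) (run-twoOneChain j m []) ⟩
    run c (replicate j 2 ++ replicate m 1 ++ [])       ≡⟨ adds-2⁵ (replicate j 2 ++ replicate m 1 ++ []) ⟩
    just (replicate (5 + j) 2 ++ replicate m 1 ++ [])  ≡⟨ cong (λ r → just (replicate (5 + j) 2 ++ r)) (++-identityʳ _) ⟩
    just (twoOne n (5 + j))                            ∎
  same-com : comCols (columns (base ++ collision₁)) ≡ comCols (columns (base ++ collision₂))
  same-com = begin
    comCols (columns (base ++ collision₁))       ≡⟨ cong comCols (columns-++ base collision₁) ⟩
    comCols (columns collision₁ ++ columns base) ≡⟨⟩
    comCols (columns collision₂ ++ columns base) ≡⟨ cong comCols (columns-++ base collision₂) ⟨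
    comCols (columns (base ++ collision₂))       ∎

FMultFree⇒≤4 : ∀ n a → ((α : Composition) → α ↭ twoOne n a → FMultFree α) → a ≤ 4
FMultFree⇒≤4 n a free with a ≤? 4
... | yes a≤4 = a≤4
... | no a≰4 with m≤n⇒∃[o]m+o≡n (≰⇒> a≰4)
...   | j , refl = ⊥-elim (twoOne-¬FMultFree n j (free (twoOne n (5 + j)) ↭-refl))

corollary6p4 : (n a : ℕ) → 2 * a ≤ n →
    (((α : Composition) → α ↭ twoOne n a → FMultFree α) ⇔ a ≤ 4)
corollary6p4 n a _ = mk⇔ (FMultFree⇒≤4 n a) (permutedTwoOne-FMultFree n a)
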